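{- For any edge $e=\{u,v\}$ of $G^+$: (P1) $\mathrm{dist}^{\rho(e)}(u)+1\ge \mathrm{dist}^{\alpha}(v)$; (P2) if $e\notin\mathsf{EP}(v)$, then $\mathrm{dist}^{\rho(e)}(u)+1> \mathrm{dist}^{\alpha}(v)$.
   Context: $G$ is a finite simple graph, $M$ a matching, $U$ the set of $M$-uncovered vertices. $G^+$ is obtained by adding a vertex $f$ and, for each $u\in U$, a vertex $w_u$ with edges $\{f,w_u\},\{w_u,u\}$; $M^+=M\cup\{\{w_u,u\}\}$. An alternating path is a simple path of $G^+$ whose consecutive edges alternate between $M^+$ and non-$M^+$ edges. $\mathrm{dist}^\theta(v)$ ($\theta\in\{\mathrm{odd},\mathrm{even}\}$) is the minimum length of an alternating $f$–$v$ path of parity $\theta$ ($\infty$ if none). $\mathrm{dist}^\alpha(v)=\min\{\mathrm{dist}^{\mathrm{odd}}(v),\mathrm{dist}^{\mathrm{even}}(v)\}$. $\rho(e)=\mathrm{odd}$ if $e\in M^+$ and $\mathrm{even}$ otherwise. $\mathsf{EP}(v)$ is the set of edges $e$ incident to $v$ such that some alternating path from $f$ to $v$ of length $\mathrm{dist}^\alpha(v)$ ends with $e$. -}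

module Defs where

open import Data.Nat using (ℕ; zero; suc; _≤_; _<_; _⊔_; _⊓_)
open import Data.Fin using (Fin)
open import Data.List using (List; []; _∷_; _++_; length; last)
open import Data.List.Relation.Unary.Linked using (Linked)
open import Data.List.Relation.Unary.Unique.Propositional using (Unique)
open import Data.Maybe using (Maybe; just; nothing)
open import Data.Product using (Σ; ∃; _×_; _,_)
open import Data.Sum using (_⊎_)
open import Data.Empty using (⊥)
open import Data.Unit using (⊤)
open import Relation.Nullary using (¬_)
open import Relation.Binary.PropositionalEquality using (_≡_; _≢_)

record Graph (n : ℕ) : Set₁ where
  field
    E      : Fin n → Fin n → Set
    sym    : ∀ {a b} → E a b → E b a
    irrefl : ∀ {a} → ¬ E a a

record IsMatching {n : ℕ} (G : Graph n) (M : Fin n → Fin n → Set) : Set where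
  field
    ⊆E     : ∀ {a b} → M a b → Graph.E G a b
    sym    : ∀ {a b} → M a b → M b a
    unique : ∀ {a b c} → M a b → M a c → b ≡ c

Uncovered : {n : ℕ} → (Fin n → Fin n → Set) → Fin n → Set
Uncovered M u = ¬ (∃ λ v → M u v)

-- Vertices: f, the original vertices (o a), and w u.
-- (A vertex w u with u covered is not a vertex of G⁺; it has no
-- incident edges here and never occurs on a path from f or in an edge.)

data V⁺ (n : ℕ) : Set where
  f : V⁺ n
  o : Fin n → V⁺ n
  w : Fin n → V⁺ n

Adj⁺ : {n : ℕ} → Graph n → (Fin n → Fin n → Set) → V⁺ n → V⁺ n → Set
Adj⁺ G M (o a) (o b) = Graph.E G a b
Adj⁺ G M f     (w u) = Uncovered M u
Adj⁺ G M (w u) f     = Uncovered M u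
Adj⁺ G M (w u) (o b) = (u ≡ b) × Uncovered M u
Adj⁺ G M (o b) (w u) = (u ≡ b) × Uncovered M u
Adj⁺ G M _     _     = ⊥

M⁺ : {n : ℕ} → (Fin n → Fin n → Set) → V⁺ n → V⁺ n → Set
M⁺ M (o a) (o b) = M a b
M⁺ M (w u) (o b) = (u ≡ b) × Uncovered M u
M⁺ M (o b) (w u) = (u ≡ b) × Uncovered M u
M⁺ M _     _     = ⊥

Alternates : {n : ℕ} → (V⁺ n → V⁺ n → Set) → List (V⁺ n) → Set
Alternates R (x ∷ y ∷ z ∷ r) =
  ((R x y × ¬ R y z) ⊎ (¬ R x y × R y z)) × Alternates R (y ∷ z ∷ r)
Alternates R _ = ⊤

record AltPath {n : ℕ} (G : Graph n) (M : Fin n → Fin n → Set) (v : V⁺ n) : Set where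
  field
    rest   : List (V⁺ n)
    ends   : last (f ∷ rest) ≡ just v
    simple : Unique (f ∷ rest)
    walk   : Linked (Adj⁺ G M) (f ∷ rest)
    alt    : Alternates (M⁺ M) (f ∷ rest)

  verts : List (V⁺ n)
  verts = f ∷ rest

  len : ℕ
  len = length rest

data Parity : Set where
  odd even : Parity

parity : ℕ → Parity
parity zero    = even
parity (suc k) with parity k
... | even = odd
... | odd  = even

data ℕ∞ : Set where
  fin : ℕ → ℕ∞
  ∞   : ℕ∞

suc∞ : ℕ∞ → ℕ∞
suc∞ (fin k) = fin (suc k)
suc∞ ∞       = ∞

min∞ : ℕ∞ → ℕ∞ → ℕ∞
min∞ (fin a) (fin b) = fin (a ⊓ b)
min∞ (fin a) ∞       = fin a
min∞ ∞       d       = d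

_≤∞_ : ℕ∞ → ℕ∞ → Set
fin a ≤∞ fin b = a ≤ b
fin a ≤∞ ∞     = ⊤
∞     ≤∞ fin b = ⊥
∞     ≤∞ ∞     = ⊤

_<∞_ : ℕ∞ → ℕ∞ → Set
fin a <∞ fin b = a < b
fin a <∞ ∞     = ⊤
∞     <∞ _     = ⊥

IsDist : {n : ℕ} → Graph n → (Fin n → Fin n → Set) → Parity → V⁺ n → ℕ∞ → Set
IsDist G M θ v (fin k) =
  (Σ (AltPath G M v) λ P → AltPath.len P ≡ k × parity k ≡ θ)
  × (∀ (P : AltPath G M v) → parity (AltPath.len P) ≡ θ → k ≤ AltPath.len P)
IsDist G M θ v ∞ =
  ∀ (P : AltPath G M v) → parity (AltPath.len P) ≢ θ

IsDistα : {n : ℕ} → Graph n → (Fin n → Fin n → Set) → V⁺ n → ℕ∞ → Set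
IsDistα G M v d =
  Σ ℕ∞ λ d₁ → Σ ℕ∞ λ d₂ →
    IsDist G M odd v d₁ × IsDist G M even v d₂ × d ≡ min∞ d₁ d₂

Rho : {n : ℕ} → (Fin n → Fin n → Set) → V⁺ n → V⁺ n → Parity → Set
Rho M u v θ = (M⁺ M u v × θ ≡ odd) ⊎ (¬ M⁺ M u v × θ ≡ even)

InEP : {n : ℕ} → Graph n → (Fin n → Fin n → Set) → V⁺ n → V⁺ n → Set
InEP G M u v =
  Adj⁺ G M u v ×
  (Σ ℕ λ k → IsDistα G M v (fin k) ×
    (Σ (AltPath G M v) λ P → AltPath.len P ≡ k ×
      (Σ (List (V⁺ _)) λ pre → AltPath.verts P ≡ pre ++ (u ∷ v ∷ []))))

-- Take a shortest alternating f–u path P of parity ρ(e), say of length k.  If v already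
-- lies on P, the initial segment of P up to v is an alternating path of length at most k.
-- Otherwise P followed by e is again a simple path, and it alternates because the edge
-- after an even-length (odd-length) prefix of an alternating path from f is outside
-- (inside) M⁺, which is precisely the condition ρ(e) = parity k.  So v has an alternating
-- path of length k + 1 ending with e, and if dist^α(v) = k + 1 this path puts e in EP(v).
module Submission where

open import Defs
open import Data.Nat using (ℕ; suc; _+_; _≤_; s≤s)
open import Data.Nat.Properties
  using (≤-refl; ≤-trans; n≤1+n; m≤m+n; m⊓n≤m; m⊓n≤n; m≤n⇒m<n∨m≡n; +-suc; +-comm)
open import Data.Fin using (Fin) renaming (_≟_ to _≟ᶠ_)
open import Data.Product using (_×_; _,_; Σ; ∃; map₂)
open import Data.Sum using (_⊎_; inj₁; inj₂)
open import Data.Empty using (⊥-elim)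
open import Data.Unit using (tt)
open import Data.Maybe using (just)
open import Data.Maybe.Properties using (just-injective)
open import Data.Maybe.Relation.Binary.Connected using (Connected; just)
open import Data.List using (List; []; _∷_; _++_; _∷ʳ_; [_]; length; last; initLast; _∷ʳ′_)
open import Data.List.Properties using (++-assoc; ∷ʳ-++; length-++)
open import Data.List.Relation.Unary.All using ([])
import Data.List.Relation.Unary.All.Properties as All
open import Data.List.Relation.Unary.Any using (here; there)
open import Data.List.Relation.Unary.Linked using (Linked; []; [-]; _∷_)
import Data.List.Relation.Unary.Linked.Properties as Linked
open import Data.List.Relation.Unary.Unique.Propositional using (Unique; []; _∷_)
import Data.List.Relation.Unary.Unique.Propositional.Properties as Unique
open import Data.List.Membership.Propositional using (_∈_; _∉_)
open import Data.List.Membership.Propositional.Properties using (∈-∃++)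
open import Relation.Binary.Definitions using (DecidableEquality)
open import Relation.Nullary using (¬_; yes; no)
open import Relation.Nullary.Decidable using (map′)
open import Relation.Binary.PropositionalEquality using (_≡_; _≢_; refl; sym; trans; cong; subst)

module _ {A : Set} where

  last-∷ʳ : ∀ (xs : List A) v → last (xs ∷ʳ v) ≡ just v
  last-∷ʳ []           v = refl
  last-∷ʳ (x ∷ [])     v = refl
  last-∷ʳ (x ∷ y ∷ xs) v = last-∷ʳ (y ∷ xs) v

  last≡just⇒∷ʳ : ∀ (xs : List A) {u} → last xs ≡ just u → ∃ λ pre → xs ≡ pre ∷ʳ u
  last≡just⇒∷ʳ xs eq with initLast xs
  last≡just⇒∷ʳ .(pre ∷ʳ x) eq | pre ∷ʳ′ x
    rewrite just-injective (trans (sym (last-∷ʳ pre x)) eq) = pre , refl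

  Unique-++⁻ˡ : ∀ (xs : List A) {ys} → Unique (xs ++ ys) → Unique xs
  Unique-++⁻ˡ []       _          = []
  Unique-++⁻ˡ (x ∷ xs) (x∉ ∷ uniq) = All.++⁻ˡ xs x∉ ∷ Unique-++⁻ˡ xs uniq

  Unique-∷ʳ : ∀ {xs : List A} {v} → Unique xs → v ∉ xs → Unique (xs ∷ʳ v)
  Unique-∷ʳ uniq v∉xs = Unique.++⁺ uniq ([] ∷ []) λ { (v∈xs , here refl) → v∉xs v∈xs }

  Linked-++⁻ˡ : ∀ {R : A → A → Set} (xs : List A) {ys} → Linked R (xs ++ ys) → Linked R xs
  Linked-++⁻ˡ []           _         = []
  Linked-++⁻ˡ (x ∷ [])     _         = [-]
  Linked-++⁻ˡ (x ∷ y ∷ xs) (r ∷ rs)  = r ∷ Linked-++⁻ˡ (y ∷ xs) rs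

  Linked-∷ʳ : ∀ {R : A → A → Set} {xs u v} →
    Linked R xs → last xs ≡ just u → R u v → Linked R (xs ∷ʳ v)
  Linked-∷ʳ {R} {v = v} rs eq r =
    Linked.++⁺ rs (subst (λ m → Connected R m (just v)) (sym eq) (just r)) [-]

flip : Parity → Parity
flip odd  = even
flip even = odd

parity-suc : ∀ k → parity (suc k) ≡ flip (parity k)
parity-suc k with parity k
... | odd  = refl
... | even = refl

module _ {n : ℕ} (R : V⁺ n → V⁺ n → Set) where

  -- With R = M⁺ this says ρ({x,y}) = θ.
  EdgeParity : Parity → V⁺ n → V⁺ n → Set
  EdgeParity odd  x y = R x y
  EdgeParity even x y = ¬ R x y

  AlternatesAt : V⁺ n → V⁺ n → V⁺ n → Set
  AlternatesAt x y z = (R x y × ¬ R y z) ⊎ (¬ R x y × R y z)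

  alternatesAt : ∀ θ {x y z} →
    EdgeParity θ x y → EdgeParity (flip θ) y z → AlternatesAt x y z
  alternatesAt odd  p q = inj₁ (p , q)
  alternatesAt even p q = inj₂ (p , q)

  alternatesAt-next : ∀ θ {x y z} →
    AlternatesAt x y z → EdgeParity θ x y → EdgeParity (flip θ) y z
  alternatesAt-next odd  (inj₁ (_ , ¬r)) _  = ¬r
  alternatesAt-next odd  (inj₂ (¬r , _)) r  = ⊥-elim (¬r r)
  alternatesAt-next even (inj₁ (r , _))  ¬r = ⊥-elim (¬r r)
  alternatesAt-next even (inj₂ (_ , r))  _  = r

  Alternates-++⁻ˡ : ∀ xs {ys} → Alternates R (xs ++ ys) → Alternates R xs
  Alternates-++⁻ˡ []               _          = tt
  Alternates-++⁻ˡ (x ∷ [])         _          = tt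
  Alternates-++⁻ˡ (x ∷ y ∷ [])     _          = tt
  Alternates-++⁻ˡ (x ∷ y ∷ z ∷ xs) (a , alt)  = a , Alternates-++⁻ˡ (y ∷ z ∷ xs) alt

  -- Convention: an edge preceded by j edges of the walk has parity `parity j`.
  Alternates-∷ʳ : ∀ j r {x y u v} →
    Alternates R (x ∷ y ∷ r) → EdgeParity (parity j) x y →
    last (y ∷ r) ≡ just u → EdgeParity (parity (length r + suc j)) u v →
    Alternates R (x ∷ y ∷ r ∷ʳ v)
  Alternates-∷ʳ j [] _ p refl q =
    alternatesAt (parity j) p (subst (λ θ → EdgeParity θ _ _) (parity-suc j) q) , tt
  Alternates-∷ʳ j (z ∷ r) {u = u} {v} (a , alt) p eq q =
    a , Alternates-∷ʳ (suc j) r alt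
          (subst (λ θ → EdgeParity θ _ _) (sym (parity-suc j)) (alternatesAt-next (parity j) a p))
          eq
          (subst (λ k → EdgeParity (parity k) u v) (sym (+-suc (length r) (suc j))) q)

Rho⇒EdgeParity : ∀ {n} {M : Fin n → Fin n → Set} {u v θ} → Rho M u v θ → EdgeParity (M⁺ M) θ u v
Rho⇒EdgeParity (inj₁ (m , refl))  = m
Rho⇒EdgeParity (inj₂ (¬m , refl)) = ¬m

≤∞-trans : ∀ {a b c} → a ≤∞ b → b ≤∞ c → a ≤∞ c
≤∞-trans {fin _} {fin _} {fin _} p  q  = ≤-trans p q
≤∞-trans {fin _} {_}     {∞}     _  _  = tt
≤∞-trans {fin _} {∞}     {fin _} _  ()
≤∞-trans {∞}     {∞}     {∞}     _  _  = tt
≤∞-trans {∞}     {∞}     {fin _} _  ()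

≤∞-∞ : ∀ d → d ≤∞ ∞
≤∞-∞ (fin _) = tt
≤∞-∞ ∞       = tt

min∞-≤ˡ : ∀ a b → min∞ a b ≤∞ a
min∞-≤ˡ (fin a) (fin b) = m⊓n≤m a b
min∞-≤ˡ (fin a) ∞       = ≤-refl
min∞-≤ˡ ∞       b       = ≤∞-∞ b

min∞-≤ʳ : ∀ a b → min∞ a b ≤∞ b
min∞-≤ʳ (fin a) (fin b) = m⊓n≤n a b
min∞-≤ʳ (fin a) ∞       = tt
min∞-≤ʳ ∞       (fin b) = ≤-refl
min∞-≤ʳ ∞       ∞       = tt

≤∞⇒<∞-suc : ∀ {d k} → d ≤∞ fin k → d <∞ fin (suc k)
≤∞⇒<∞-suc {fin _} p = s≤s p

≤∞∧≢⇒<∞ : ∀ {d k} → d ≤∞ fin k → d ≢ fin k → d <∞ fin k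
≤∞∧≢⇒<∞ {fin m} m≤k m≢k with m≤n⇒m<n∨m≡n m≤k
... | inj₁ m<k = m<k
... | inj₂ refl = ⊥-elim (m≢k refl)

<∞-suc⇒≤∞ : ∀ {d k} → d <∞ fin (suc k) → d ≤∞ fin (suc k)
<∞-suc⇒≤∞ {fin _} (s≤s p) = ≤-trans p (n≤1+n _)

module _ {n : ℕ} where

  o-injective : ∀ {a b : Fin n} → o a ≡ o b → a ≡ b
  o-injective refl = refl

  w-injective : ∀ {a b : Fin n} → w a ≡ w b → a ≡ b
  w-injective refl = refl

  _≟_ : DecidableEquality (V⁺ n)
  f   ≟ f   = yes refl
  o a ≟ o b = map′ (cong o) o-injective (a ≟ᶠ b)
  w a ≟ w b = map′ (cong w) w-injective (a ≟ᶠ b)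
  f   ≟ o _ = no λ ()
  f   ≟ w _ = no λ ()
  o _ ≟ f   = no λ ()
  o _ ≟ w _ = no λ ()
  w _ ≟ f   = no λ ()
  w _ ≟ o _ = no λ ()

  open import Data.List.Membership.DecPropositional _≟_ using (_∈?_)

  module _ {G : Graph n} {M : Fin n → Fin n → Set} where

    open AltPath

    trivialPath : AltPath G M f
    trivialPath = record { rest = [] ; ends = refl ; simple = [] ∷ [] ; walk = [-] ; alt = tt }

    truncate : ∀ {u v} (P : AltPath G M u) → v ∈ verts P →
      Σ (AltPath G M v) λ Q → len Q ≤ len P
    truncate P (here refl) = trivialPath , m≤m+n 0 (len P)
    truncate {v = v} P (there v∈rest) with ∈-∃++ v∈rest
    ... | ys , zs , rest≡ = Q , len≤
      where
        rest≡′ : rest P ≡ (ys ∷ʳ v) ++ zs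
        rest≡′ = trans rest≡ (sym (++-assoc ys [ v ] zs))

        verts≡ : verts P ≡ (f ∷ ys ∷ʳ v) ++ zs
        verts≡ = cong (f ∷_) rest≡′

        Q : AltPath G M v
        Q = record
          { rest   = ys ∷ʳ v
          ; ends   = last-∷ʳ (f ∷ ys) v
          ; simple = Unique-++⁻ˡ (f ∷ ys ∷ʳ v) (subst Unique verts≡ (simple P))
          ; walk   = Linked-++⁻ˡ (f ∷ ys ∷ʳ v) (subst (Linked (Adj⁺ G M)) verts≡ (walk P))
          ; alt    = Alternates-++⁻ˡ (M⁺ M) (f ∷ ys ∷ʳ v) (subst (Alternates (M⁺ M)) verts≡ (alt P))
          }

        len≤ : len Q ≤ len P
        len≤ = subst (len Q ≤_) (sym (trans (cong length rest≡′) (length-++ (ys ∷ʳ v))))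
                 (m≤m+n (len Q) (length zs))

    extend : ∀ {u v} (P : AltPath G M u) → v ∉ verts P → Adj⁺ G M u v →
      EdgeParity (M⁺ M) (parity (len P)) u v → AltPath G M v
    extend {u} {v} P v∉P adj e = record
      { rest   = rest P ∷ʳ v
      ; ends   = last-∷ʳ (verts P) v
      ; simple = Unique-∷ʳ (simple P) v∉P
      ; walk   = Linked-∷ʳ (walk P) (ends P) adj
      ; alt    = alternates (rest P) (alt P) (ends P) e
      }
      where
        -- The first edge {f, w_u} is never in M⁺.
        alternates : ∀ r → Alternates (M⁺ M) (f ∷ r) → last (f ∷ r) ≡ just u →
          EdgeParity (M⁺ M) (parity (length r)) u v → Alternates (M⁺ M) (f ∷ r ∷ʳ v)
        alternates []      _   _  _ = tt
        alternates (y ∷ r) alt eq e =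
          Alternates-∷ʳ (M⁺ M) 0 r alt (λ ()) eq
            (subst (λ k → EdgeParity (M⁺ M) (parity k) u v) (+-comm 1 (length r)) e)

    len-extend : ∀ {u v} (P : AltPath G M u) (v∉P : v ∉ verts P) (adj : Adj⁺ G M u v)
      (e : EdgeParity (M⁺ M) (parity (len P)) u v) →
      len (extend P v∉P adj e) ≡ suc (len P)
    len-extend P _ _ _ = trans (length-++ (rest P)) (+-comm (len P) 1)

    IsDist-minimal : ∀ {θ v d} → IsDist G M θ v d →
      (P : AltPath G M v) → parity (len P) ≡ θ → d ≤∞ fin (len P)
    IsDist-minimal {d = fin _} (_ , minimal) P par = minimal P par
    IsDist-minimal {d = ∞}     none          P par = ⊥-elim (none P par)

    IsDistα-minimal : ∀ {v d} → IsDistα G M v d → (P : AltPath G M v) → d ≤∞ fin (len P)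
    IsDistα-minimal (d₁ , d₂ , distOdd , distEven , refl) P with parity (len P) in par
    ... | odd  = ≤∞-trans (min∞-≤ˡ d₁ d₂) (IsDist-minimal distOdd P par)
    ... | even = ≤∞-trans (min∞-≤ʳ d₁ d₂) (IsDist-minimal distEven P par)

    distα-across-edge : ∀ {u v d} → IsDistα G M v d → (P : AltPath G M u) →
      Adj⁺ G M u v → EdgeParity (M⁺ M) (parity (len P)) u v →
      d ≤∞ fin (suc (len P)) × (¬ InEP G M u v → d <∞ fin (suc (len P)))
    distα-across-edge {u} {v} {d} distα P adj e with v ∈? verts P
    ... | yes v∈P = <∞-suc⇒≤∞ d<P+1 , λ _ → d<P+1
      where
        d<P+1 : d <∞ fin (suc (len P))
        d<P+1 = let Q , Q≤P = truncate P v∈P in ≤∞⇒<∞-suc (≤∞-trans (IsDistα-minimal distα Q) Q≤P)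
    ... | no v∉P = d≤P+1 , λ ¬EP → ≤∞∧≢⇒<∞ d≤P+1 λ { refl →
                     ¬EP (adj , _ , distα , Q , len-extend P v∉P adj e , endsWith-uv) }
      where
        Q : AltPath G M v
        Q = extend P v∉P adj e

        d≤P+1 : d ≤∞ fin (suc (len P))
        d≤P+1 = subst (λ k → d ≤∞ fin k) (len-extend P v∉P adj e) (IsDistα-minimal distα Q)

        endsWith-uv : ∃ λ pre → verts Q ≡ pre ++ u ∷ v ∷ []
        endsWith-uv with pre , verts≡ ← last≡just⇒∷ʳ (verts P) (ends P) =
          pre , trans (cong (_∷ʳ v) verts≡) (∷ʳ-++ pre u [ v ])

lemma2 : ∀ {n} (G : Graph n) (M : Fin n → Fin n → Set) → IsMatching G M →
    (u v : V⁺ n) → Adj⁺ G M u v →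
    (θ : Parity) → Rho M u v θ →
    (d₁ d₂ : ℕ∞) → IsDist G M θ u d₁ → IsDistα G M v d₂ →
    (d₂ ≤∞ suc∞ d₁)
    × (¬ InEP G M u v → ∀ (k : ℕ) → d₁ ≡ fin k → d₂ <∞ fin (suc k))
lemma2 G M _ u v adj θ ρ ∞ d₂ _ _ = ≤∞-∞ d₂ , λ _ _ ()
lemma2 G M _ u v adj θ ρ (fin _) d₂ ((P , refl , par) , _) distα =
  map₂ (λ strict ¬EP _ → λ { refl → strict ¬EP })
    (distα-across-edge distα P adj (subst (λ θ → EdgeParity (M⁺ M) θ u v) (sym par) (Rho⇒EdgeParity ρ)))
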